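{- A partition $\lambda$ is weakly Latin if and only if it is Latin.
   Context: A tableau of shape $\lambda$ is the Young diagram of $\lambda$ (row $i$ has $\lambda_i$ cells) with a positive integer in each cell. $\lambda'$ denotes the conjugate partition. $\lambda$ is Latin if there is a tableau of shape $\lambda$ in which no two cells in the same row or column have equal entries and in which, for every $i$, the integer $i$ occurs exactly $\lambda'_i$ times. A tableau $T$ of shape $\lambda$ is weakly Latin if (a) for every $i$, the set of entries in row $i$ of $T$ is $\{1,2,\ldots,\lambda_i\}$, and (b) for every column $j$ and every $k\ge1$, at most $k$ entries in column $j$ are $\le k$. $\lambda$ is weakly Latin if a weakly Latin tableau of shape $\lambda$ exists. -}

module Defs where

open import Data.Nat using (ℕ; zero; suc; _+_; _≤_; _<_; _≤?_; _<?_; _≟_)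
open import Data.List using (List; []; _∷_; length)
open import Data.Product using (Σ; ∃; _×_; _,_)
open import Relation.Nullary using (¬_; yes; no; Dec)
open import Relation.Nullary.Decidable using (_×-dec_)
open import Relation.Binary.PropositionalEquality using (_≡_)

-- Conventions: rows and columns are indexed from 0; entries are natural numbers,
-- required to be positive where the paper requires positive integers.

part : List ℕ → ℕ → ℕ
part []       r       = 0
part (x ∷ xs) zero    = x
part (x ∷ xs) (suc r) = part xs r

data Decreasing : List ℕ → Set where
  dec-[] : Decreasing []
  dec-[x] : ∀ {x} → Decreasing (x ∷ [])
  dec-∷ : ∀ {x y xs} → y ≤ x → Decreasing (y ∷ xs) → Decreasing (x ∷ y ∷ xs)

data AllPositive : List ℕ → Set where
  pos-[] : AllPositive []
  pos-∷ : ∀ {x xs} → 1 ≤ x → AllPositive xs → AllPositive (x ∷ xs)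

IsPartition : List ℕ → Set
IsPartition λ′ = Decreasing λ′ × AllPositive λ′

-- A tableau: an assignment of a number to each position; only the values on
-- cells (r , c) with r < length λ and c < part λ r are relevant.
Tableau : Set
Tableau = ℕ → ℕ → ℕ

InShape : List ℕ → ℕ → ℕ → Set
InShape λ′ r c = r < length λ′ × c < part λ′ r

countBelow : (P : ℕ → Set) → ((k : ℕ) → Dec (P k)) → ℕ → ℕ
countBelow P d zero = 0
countBelow P d (suc n) with d n
... | yes _ = suc (countBelow P d n)
... | no  _ = countBelow P d n

sumBelow : (ℕ → ℕ) → ℕ → ℕ
sumBelow f zero = 0
sumBelow f (suc n) = sumBelow f n + f n

conj : List ℕ → ℕ → ℕ
conj λ′ i = countBelow (λ r → i ≤ part λ′ r) (λ r → i ≤? part λ′ r) (length λ′)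

occurrences : List ℕ → Tableau → ℕ → ℕ
occurrences λ′ T v =
  sumBelow (λ r → countBelow (λ c → T r c ≡ v) (λ c → T r c ≟ v) (part λ′ r)) (length λ′)

columnAtMost : List ℕ → Tableau → ℕ → ℕ → ℕ
columnAtMost λ′ T c k =
  countBelow (λ r → c < part λ′ r × T r c ≤ k)
             (λ r → (c <? part λ′ r) ×-dec (T r c ≤? k)) (length λ′)

IsLatinTableau : List ℕ → Tableau → Set
IsLatinTableau λ′ T =
  (∀ r c → InShape λ′ r c → 1 ≤ T r c)
  × (∀ r c c′ → InShape λ′ r c → InShape λ′ r c′ → ¬ c ≡ c′ → ¬ T r c ≡ T r c′)
  × (∀ r r′ c → InShape λ′ r c → InShape λ′ r′ c → ¬ r ≡ r′ → ¬ T r c ≡ T r′ c)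
  × (∀ i → 1 ≤ i → occurrences λ′ T i ≡ conj λ′ i)

IsLatin : List ℕ → Set
IsLatin λ′ = Σ Tableau (IsLatinTableau λ′)

IsWeaklyLatinTableau : List ℕ → Tableau → Set
IsWeaklyLatinTableau λ′ T =
  -- (a) the set of entries of row r is {1, ..., λ_r}
  (∀ r → r < length λ′ →
       (∀ c → c < part λ′ r → 1 ≤ T r c × T r c ≤ part λ′ r)
     × (∀ v → 1 ≤ v → v ≤ part λ′ r → ∃ λ c → c < part λ′ r × T r c ≡ v))
  -- (b) in every column at most k entries are ≤ k, for every k ≥ 1
  × (∀ c k → 1 ≤ k → columnAtMost λ′ T c k ≤ k)

IsWeaklyLatin : List ℕ → Set
IsWeaklyLatin λ′ = Σ Tableau (IsWeaklyLatinTableau λ′)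

-- Latin ⇒ weakly Latin. The entries of a row of a Latin tableau are distinct and positive, so row r has at most
-- min(k, λ_r) entries ≤ k. Counting the cells with entry ≤ k value by value instead, occurrences = conj gives exactly
-- Σ_r min(k, λ_r); hence every row attains its bound, and k = λ_r shows that row r is a permutation of 1, …, λ_r.
--
-- Weakly Latin ⇒ Latin. The rows are already permutations of 1, …, λ_r, which forces occurrences = conj, so only
-- column-distinctness is missing; it is obtained one value at a time. Suppose the values below a are column-distinct
-- and a occurs twice in column x. Condition (b) for k = a leaves some b < a missing from x. Swapping a and b in the
-- rows of an alternating a/b path (a Kempe chain) that starts at one of the repeated a's keeps the rows permutations,
-- keeps (b) for k ≥ a and the distinctness of the values below a, and strictly increases the number of columns
-- containing a; so after finitely many swaps a is column-distinct as well.

{-# OPTIONS --safe #-}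
module Submission where

open import Defs
open import Data.Empty using (⊥; ⊥-elim)
open import Data.List using (List; []; _∷_; length)
open import Data.List.Relation.Unary.Any using (Any; here; there; any?)
open import Data.Nat using (ℕ; zero; suc; _+_; _∸_; _≤_; _<_; _≤?_; _<?_; _≟_; z≤n; s≤s; _⊓_)
open import Data.Nat.Properties
open import Algebra.Properties.CommutativeSemigroup +-commutativeSemigroup using (interchange)
open import Data.List.Membership.DecPropositional _≟_ using (_∈_; _∈?_; find)
open import Data.Product using (∃; ∃₂; _×_; _,_; proj₁; proj₂)
open import Data.Sum using (_⊎_; inj₁; inj₂; map₁)
open import Data.Unit using (⊤; tt)
open import Relation.Nullary using (¬_; yes; no; Dec)
open import Relation.Nullary.Decidable using (_×-dec_; ¬?)
open import Relation.Unary using (Decidable)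
open import Relation.Binary.PropositionalEquality

-- Counting below a bound

private variable
  P Q R : ℕ → Set

_⊆_below_ : (ℕ → Set) → (ℕ → Set) → ℕ → Set
P ⊆ Q below n = ∀ x → x < n → P x → Q x

restrict : ∀ {n} {A : ℕ → Set} → (∀ x → x < suc n → A x) → ∀ x → x < n → A x
restrict f x x<n = f x (m<n⇒m<1+n x<n)

InjectiveBelow : ℕ → (ℕ → ℕ) → Set
InjectiveBelow n f = ∀ {x y} → x < n → y < n → f x ≡ f y → x ≡ y

InjectiveOn : (ℕ → Set) → ℕ → (ℕ → ℕ) → Set
InjectiveOn Q n h = ∀ {x y} → x < n → y < n → Q x → Q y → h x ≡ h y → x ≡ y

injectiveOn-restrict : ∀ {n h} → InjectiveOn Q (suc n) h → InjectiveOn Q n h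
injectiveOn-restrict inj x<n y<n = inj (m<n⇒m<1+n x<n) (m<n⇒m<1+n y<n)

countBelow-cong : ∀ (P? : Decidable P) (Q? : Decidable Q) n →
  P ⊆ Q below n → Q ⊆ P below n → countBelow P P? n ≡ countBelow Q Q? n
countBelow-cong P? Q? zero P⊆Q Q⊆P = refl
countBelow-cong P? Q? (suc n) P⊆Q Q⊆P with P? n | Q? n
... | yes p | yes q = cong suc (countBelow-cong P? Q? n (restrict P⊆Q) (restrict Q⊆P))
... | yes p | no ¬q = ⊥-elim (¬q (P⊆Q n ≤-refl p))
... | no ¬p | yes q = ⊥-elim (¬p (Q⊆P n ≤-refl q))
... | no ¬p | no ¬q = countBelow-cong P? Q? n (restrict P⊆Q) (restrict Q⊆P)

countBelow≤n : ∀ (P? : Decidable P) n → countBelow P P? n ≤ n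
countBelow≤n P? zero = z≤n
countBelow≤n P? (suc n) with P? n
... | yes _ = s≤s (countBelow≤n P? n)
... | no _  = m≤n⇒m≤1+n (countBelow≤n P? n)

countBelow-mono : ∀ (P? : Decidable P) (Q? : Decidable Q) n →
  P ⊆ Q below n → countBelow P P? n ≤ countBelow Q Q? n
countBelow-mono P? Q? zero P⊆Q = z≤n
countBelow-mono P? Q? (suc n) P⊆Q with P? n | Q? n
... | yes p | yes q = s≤s (countBelow-mono P? Q? n (restrict P⊆Q))
... | yes p | no ¬q = ⊥-elim (¬q (P⊆Q n ≤-refl p))
... | no ¬p | yes q = m≤n⇒m≤1+n (countBelow-mono P? Q? n (restrict P⊆Q))
... | no ¬p | no ¬q = countBelow-mono P? Q? n (restrict P⊆Q)

countBelow-mono-< : ∀ (P? : Decidable P) (Q? : Decidable Q) n → P ⊆ Q below n →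
  ∀ {y} → y < n → Q y → ¬ P y → countBelow P P? n < countBelow Q Q? n
countBelow-mono-< P? Q? (suc n) P⊆Q {y} y<1+n qy ¬py with P? n | Q? n | m<1+n⇒m<n∨m≡n y<1+n
... | yes p | _     | inj₂ refl = ⊥-elim (¬py p)
... | no ¬p | no ¬q | inj₂ refl = ⊥-elim (¬q qy)
... | no ¬p | yes q | inj₂ refl = s≤s (countBelow-mono P? Q? n (restrict P⊆Q))
... | yes p | no ¬q | inj₁ _    = ⊥-elim (¬q (P⊆Q n ≤-refl p))
... | yes p | yes q | inj₁ y<n  = s≤s (countBelow-mono-< P? Q? n (restrict P⊆Q) y<n qy ¬py)
... | no ¬p | yes q | inj₁ y<n  = m≤n⇒m≤1+n (countBelow-mono-< P? Q? n (restrict P⊆Q) y<n qy ¬py)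
... | no ¬p | no ¬q | inj₁ y<n  = countBelow-mono-< P? Q? n (restrict P⊆Q) y<n qy ¬py

countBelow≡n⇒all : ∀ (P? : Decidable P) n → countBelow P P? n ≡ n → ∀ x → x < n → P x
countBelow≡n⇒all P? (suc n) eq x x<1+n with P? n | m<1+n⇒m<n∨m≡n x<1+n
... | yes p | inj₂ refl = p
... | yes p | inj₁ x<n  = countBelow≡n⇒all P? n (suc-injective eq) x x<n
... | no ¬p | _         = ⊥-elim (<-irrefl eq (s≤s (countBelow≤n P? n)))

countBelow-none : ∀ (P? : Decidable P) n → (∀ x → x < n → ¬ P x) → countBelow P P? n ≡ 0
countBelow-none P? zero none = refl
countBelow-none P? (suc n) none with P? n
... | yes p = ⊥-elim (none n ≤-refl p)
... | no _  = countBelow-none P? n (restrict none)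

countBelow-pos : ∀ (P? : Decidable P) n → ∀ {x} → x < n → P x → 0 < countBelow P P? n
countBelow-pos P? (suc n) {x} x<1+n px with P? n | m<1+n⇒m<n∨m≡n x<1+n
... | yes _ | _         = s≤s z≤n
... | no ¬p | inj₂ refl = ⊥-elim (¬p px)
... | no ¬p | inj₁ x<n  = countBelow-pos P? n x<n px

countBelow-⊤ : ∀ n → countBelow (λ _ → ⊤) (λ _ → yes tt) n ≡ n
countBelow-⊤ zero    = refl
countBelow-⊤ (suc n) = cong suc (countBelow-⊤ n)

countBelow-disjoint-∪ : ∀ (P? : Decidable P) (Q? : Decidable Q) (R? : Decidable R) n →
  R ⊆ (λ x → P x ⊎ Q x) below n → P ⊆ R below n → Q ⊆ R below n → (∀ x → x < n → P x → ¬ Q x) →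
  countBelow P P? n + countBelow Q Q? n ≡ countBelow R R? n
countBelow-disjoint-∪ P? Q? R? zero R⊆P∪Q P⊆R Q⊆R disjoint = refl
countBelow-disjoint-∪ P? Q? R? (suc n) R⊆P∪Q P⊆R Q⊆R disjoint
  with P? n | Q? n | R? n | countBelow-disjoint-∪ P? Q? R? n (restrict R⊆P∪Q) (restrict P⊆R) (restrict Q⊆R) (restrict disjoint)
... | yes p | yes q | _     | _  = ⊥-elim (disjoint n ≤-refl p q)
... | yes p | no _  | yes _ | ih = cong suc ih
... | yes p | no _  | no ¬r | _  = ⊥-elim (¬r (P⊆R n ≤-refl p))
... | no _  | yes q | yes _ | ih = trans (+-suc _ _) (cong suc ih)
... | no _  | yes q | no ¬r | _  = ⊥-elim (¬r (Q⊆R n ≤-refl q))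
... | no _  | no _  | no _  | ih = ih
... | no ¬p | no ¬q | yes r | _ with R⊆P∪Q n ≤-refl r
...   | inj₁ p = ⊥-elim (¬p p)
...   | inj₂ q = ⊥-elim (¬q q)

countBelow-injection : ∀ (Q? : Decidable Q) (P? : Decidable P) (h : ℕ → ℕ) n m →
  (∀ x → x < n → Q x → h x < m × P (h x)) → InjectiveOn Q n h →
  countBelow Q Q? n ≤ countBelow P P? m
countBelow-injection Q? P? h zero m maps inj = z≤n
countBelow-injection {Q = Q} {P = P} Q? P? h (suc n) m maps inj with Q? n
... | no _  = countBelow-injection Q? P? h n m (restrict maps) (injectiveOn-restrict inj)
... | yes q = <-≤-trans (s≤s (countBelow-injection Q? P′? h n m maps′ (injectiveOn-restrict inj)))
                        (countBelow-mono-< P′? P? m (λ _ _ → proj₁) hn<m Phn (λ (_ , hn≢hn) → hn≢hn refl))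
  where
  -- By injectivity the images of all x < n stay in P ∖ {h n}.
  P′ : ℕ → Set
  P′ z = P z × ¬ z ≡ h n
  P′? : Decidable P′
  P′? z = P? z ×-dec ¬? (z ≟ h n)
  hn<m : h n < m
  hn<m = proj₁ (maps n ≤-refl q)
  Phn : P (h n)
  Phn = proj₂ (maps n ≤-refl q)
  maps′ : ∀ x → x < n → Q x → h x < m × P′ (h x)
  maps′ x x<n qx = proj₁ (maps x (m<n⇒m<1+n x<n) qx) , proj₂ (maps x (m<n⇒m<1+n x<n) qx) ,
                   λ hx≡hn → <-irrefl (inj (m<n⇒m<1+n x<n) ≤-refl qx q hx≡hn) x<n

countBelow-injectionBelow : ∀ (Q? : Decidable Q) (h : ℕ → ℕ) n m →
  (∀ x → x < n → Q x → h x < m) → InjectiveOn Q n h → countBelow Q Q? n ≤ m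
countBelow-injectionBelow Q? h n m maps inj =
  ≤-trans (countBelow-injection Q? (λ _ → yes tt) h n m (λ x x<n qx → maps x x<n qx , tt) inj)
          (≤-reflexive (countBelow-⊤ m))

-- If y were missed, f would inject [0, m) into [0, m) ∖ {y}.
injective⇒surjective : ∀ (f : ℕ → ℕ) m → (∀ x → x < m → f x < m) → InjectiveBelow m f →
  ∀ {y} → y < m → ∃ λ x → x < m × f x ≡ y
injective⇒surjective f m maps inj {y} y<m with anyUpTo? (λ x → f x ≟ y) m
... | yes found = found
... | no ¬found = ⊥-elim (<-irrefl refl (begin-strict
  m                                     ≡⟨ countBelow-⊤ m ⟨
  countBelow (λ _ → ⊤) (λ _ → yes tt) m  ≤⟨ countBelow-injection (λ _ → yes tt) (λ z → ¬? (z ≟ y)) f m m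
                                             (λ x x<m _ → maps x x<m , λ fx≡y → ¬found (x , x<m , fx≡y))
                                             (λ x<m y<m _ _ → inj x<m y<m) ⟩
  countBelow (λ z → ¬ z ≡ y) (λ z → ¬? (z ≟ y)) m
                                        <⟨ countBelow-mono-< (λ z → ¬? (z ≟ y)) (λ _ → yes tt) m
                                             (λ _ _ _ → tt) y<m tt (λ y≢y → y≢y refl) ⟩
  countBelow (λ _ → ⊤) (λ _ → yes tt) m  ≡⟨ countBelow-⊤ m ⟩
  m                                     ∎))
  where open ≤-Reasoning

choiceBelow : ∀ {m} {A : ℕ → ℕ → Set} → (∀ x → x < m → ∃ (A x)) →
  ∃ λ (g : ℕ → ℕ) → ∀ x → x < m → A x (g x)
choiceBelow {m} {A} choose = g , spec
  where
  g : ℕ → ℕ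
  g x with x <? m
  ... | yes x<m = proj₁ (choose x x<m)
  ... | no _    = 0
  spec : ∀ x → x < m → A x (g x)
  spec x x<m with x <? m
  ... | yes x<m′ = proj₂ (choose x x<m′)
  ... | no x≮m   = ⊥-elim (x≮m x<m)

ascend : ∀ {S G : Set} (μ : S → ℕ) (bound : ℕ) → (∀ s → μ s ≤ bound) →
  (∀ s → G ⊎ ∃ λ s′ → μ s < μ s′) → S → G
ascend {G = G} μ bound μ≤bound step s₀ = go bound s₀ (m≤m+n bound (μ s₀))
  where
  go : ∀ fuel s → bound ≤ fuel + μ s → G
  go fuel s enough with step s
  ... | inj₁ done = done
  ... | inj₂ (s′ , μs<μs′) with fuel
  ...   | zero      = ⊥-elim (<-irrefl refl (<-≤-trans (≤-<-trans enough μs<μs′) (μ≤bound s′)))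
  ...   | suc fuel′ = go fuel′ s′ (begin
    bound             ≤⟨ enough ⟩
    suc fuel′ + μ s   ≡⟨ +-suc fuel′ (μ s) ⟨
    fuel′ + suc (μ s) ≤⟨ +-monoʳ-≤ fuel′ μs<μs′ ⟩
    fuel′ + μ s′      ∎)
    where open ≤-Reasoning

-- Finite sums

sumBelow-cong : ∀ {f g : ℕ → ℕ} n → (∀ x → x < n → f x ≡ g x) → sumBelow f n ≡ sumBelow g n
sumBelow-cong zero    f≡g = refl
sumBelow-cong (suc n) f≡g = cong₂ _+_ (sumBelow-cong n (restrict f≡g)) (f≡g n ≤-refl)

sumBelow-mono : ∀ {f g : ℕ → ℕ} n → (∀ x → x < n → f x ≤ g x) → sumBelow f n ≤ sumBelow g n
sumBelow-mono zero    f≤g = z≤n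
sumBelow-mono (suc n) f≤g = +-mono-≤ (sumBelow-mono n (restrict f≤g)) (f≤g n ≤-refl)

sumBelow-+ : ∀ (f g : ℕ → ℕ) n → sumBelow (λ i → f i + g i) n ≡ sumBelow f n + sumBelow g n
sumBelow-+ f g zero    = refl
sumBelow-+ f g (suc n) = trans (cong (_+ (f n + g n)) (sumBelow-+ f g n))
                               (interchange (sumBelow f n) (sumBelow g n) (f n) (g n))

sumBelow-zero : ∀ n → sumBelow (λ _ → 0) n ≡ 0
sumBelow-zero zero    = refl
sumBelow-zero (suc n) = cong (_+ 0) (sumBelow-zero n)

sumBelow-swap : ∀ (F : ℕ → ℕ → ℕ) n k →
  sumBelow (λ i → sumBelow (F i) n) k ≡ sumBelow (λ r → sumBelow (λ i → F i r) k) n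
sumBelow-swap F n zero    = sym (sumBelow-zero n)
sumBelow-swap F n (suc k) = trans (cong (_+ sumBelow (F k) n) (sumBelow-swap F n k))
                                  (sym (sumBelow-+ (λ r → sumBelow (λ i → F i r) k) (F k) n))

sumBelow-mono-≡⇒≡ : ∀ {f g : ℕ → ℕ} n → (∀ x → x < n → f x ≤ g x) → sumBelow f n ≡ sumBelow g n →
  ∀ x → x < n → f x ≡ g x
sumBelow-mono-≡⇒≡ {f} {g} (suc n) f≤g sums≡ x x<1+n with m<1+n⇒m<n∨m≡n x<1+n
... | inj₂ refl = last≡
  where
  last≡ : f n ≡ g n
  last≡ = ≤-antisym (f≤g n ≤-refl)
            (+-cancelˡ-≤ (sumBelow g n) (g n) (f n)
              (≤-trans (≤-reflexive (sym sums≡)) (+-monoˡ-≤ (f n) (sumBelow-mono n (restrict f≤g)))))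
... | inj₁ x<n = sumBelow-mono-≡⇒≡ n (restrict f≤g) init≡ x x<n
  where
  init≡ : sumBelow f n ≡ sumBelow g n
  init≡ = ≤-antisym (sumBelow-mono n (restrict f≤g))
            (+-cancelʳ-≤ (g n) (sumBelow g n) (sumBelow f n)
              (≤-trans (≤-reflexive (sym sums≡)) (+-monoʳ-≤ (sumBelow f n) (f≤g n ≤-refl))))

sumBelow-≥ : ∀ (f : ℕ → ℕ) n {x} → x < n → f x ≤ sumBelow f n
sumBelow-≥ f (suc n) {x} x<1+n with m<1+n⇒m<n∨m≡n x<1+n
... | inj₂ refl = m≤n+m (f x) (sumBelow f n)
... | inj₁ x<n  = ≤-trans (sumBelow-≥ f n x<n) (m≤m+n (sumBelow f n) (f n))

indicator : {A : Set} → Dec A → ℕ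
indicator (yes _) = 1
indicator (no _)  = 0

countBelow≡sumBelow-indicator : ∀ (P? : Decidable P) n → countBelow P P? n ≡ sumBelow (λ x → indicator (P? x)) n
countBelow≡sumBelow-indicator P? zero = refl
countBelow≡sumBelow-indicator P? (suc n) with P? n
... | yes _ = trans (cong suc (countBelow≡sumBelow-indicator P? n)) (+-comm 1 _)
... | no _  = trans (countBelow≡sumBelow-indicator P? n) (sym (+-identityʳ _))

sumBelow-indicator-≤ : ∀ m k → sumBelow (λ i → indicator (suc i ≤? m)) k ≡ k ⊓ m
sumBelow-indicator-≤ m zero = refl
sumBelow-indicator-≤ m (suc k) with suc k ≤? m
... | yes k<m = begin
  sumBelow _ k + 1 ≡⟨ +-comm _ 1 ⟩
  suc (sumBelow _ k) ≡⟨ cong suc (sumBelow-indicator-≤ m k) ⟩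
  suc (k ⊓ m)        ≡⟨ cong suc (m≤n⇒m⊓n≡m (<⇒≤ k<m)) ⟩
  suc k              ≡⟨ m≤n⇒m⊓n≡m k<m ⟨
  suc k ⊓ m          ∎
  where open ≡-Reasoning
... | no k≮m = begin
  sumBelow _ k + 0 ≡⟨ +-identityʳ _ ⟩
  sumBelow _ k     ≡⟨ sumBelow-indicator-≤ m k ⟩
  k ⊓ m            ≡⟨ m≥n⇒m⊓n≡n m≤k ⟩
  m                ≡⟨ m≥n⇒m⊓n≡n (m≤n⇒m≤1+n m≤k) ⟨
  suc k ⊓ m        ∎
  where
  open ≡-Reasoning
  m≤k : m ≤ k
  m≤k = ≤-pred (≰⇒> k≮m)

sumBelow-countBelow-≡ : ∀ (f : ℕ → ℕ) m → (∀ c → c < m → 1 ≤ f c) → ∀ k →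
  sumBelow (λ i → countBelow (λ c → f c ≡ suc i) (λ c → f c ≟ suc i) m) k ≡
  countBelow (λ c → f c ≤ k) (λ c → f c ≤? k) m
sumBelow-countBelow-≡ f m positive zero =
  sym (countBelow-none _ m (λ c c<m fc≤0 → <-irrefl refl (≤-trans (positive c c<m) fc≤0)))
sumBelow-countBelow-≡ f m positive (suc k) =
  trans (cong (_+ countBelow _ _ m) (sumBelow-countBelow-≡ f m positive k))
        (countBelow-disjoint-∪ (λ c → f c ≤? k) (λ c → f c ≟ suc k) (λ c → f c ≤? suc k) m
           (λ c _ fc≤1+k → map₁ ≤-pred (m<1+n⇒m<n∨m≡n (s≤s fc≤1+k)))
           (λ _ _ → m≤n⇒m≤1+n) (λ _ _ → ≤-reflexive) (λ _ _ fc≤k fc≡1+k → <-irrefl fc≡1+k (s≤s fc≤k)))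

-- Enumerations of {1, …, m}

∸1-< : ∀ {x k} → 1 ≤ x → x ≤ k → x ∸ 1 < k
∸1-< (s≤s _) x≤k = x≤k

∸1-injective : ∀ {x y} → 1 ≤ x → 1 ≤ y → x ∸ 1 ≡ y ∸ 1 → x ≡ y
∸1-injective (s≤s _) (s≤s _) eq = cong suc eq

record Enumerates (m : ℕ) (f : ℕ → ℕ) : Set where
  field
    bounded   : ∀ {c} → c < m → 1 ≤ f c × f c ≤ m
    injective : InjectiveBelow m f
    onto      : ∀ {v} → 1 ≤ v → v ≤ m → ∃ λ c → c < m × f c ≡ v

injective⇒enumerates : ∀ {m f} → (∀ {c} → c < m → 1 ≤ f c × f c ≤ m) → InjectiveBelow m f → Enumerates m f
injective⇒enumerates {m} {f} bounded injective = record { bounded = bounded ; injective = injective ; onto = onto }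
  where
  onto : ∀ {v} → 1 ≤ v → v ≤ m → ∃ λ c → c < m × f c ≡ v
  onto 1≤v v≤m with injective⇒surjective (λ c → f c ∸ 1) m
                      (λ c c<m → ∸1-< (proj₁ (bounded c<m)) (proj₂ (bounded c<m)))
                      (λ x<m y<m eq → injective x<m y<m (∸1-injective (proj₁ (bounded x<m)) (proj₁ (bounded y<m)) eq))
                      (∸1-< 1≤v v≤m)
  ... | c , c<m , eq = c , c<m , ∸1-injective (proj₁ (bounded c<m)) 1≤v eq

-- A right inverse g of f (f (g v) = v + 1) is injective, hence onto [0, m) by pigeonhole, which makes f injective.
onto⇒enumerates : ∀ {m f} → (∀ {c} → c < m → 1 ≤ f c × f c ≤ m) →
  (∀ {v} → 1 ≤ v → v ≤ m → ∃ λ c → c < m × f c ≡ v) → Enumerates m f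
onto⇒enumerates {m} {f} bounded onto = record { bounded = bounded ; injective = injective ; onto = onto }
  where
  section : ∃ λ (g : ℕ → ℕ) → ∀ v → v < m → g v < m × f (g v) ≡ suc v
  section = choiceBelow (λ v v<m → onto (s≤s z≤n) v<m)
  g : ℕ → ℕ
  g = proj₁ section
  g-spec : ∀ v → v < m → g v < m × f (g v) ≡ suc v
  g-spec = proj₂ section
  g-onto : ∀ {c} → c < m → ∃ λ v → v < m × g v ≡ c
  g-onto = injective⇒surjective g m (λ v v<m → proj₁ (g-spec v v<m))
             (λ {v} {w} v<m w<m gv≡gw → suc-injective (begin
                suc v     ≡⟨ proj₂ (g-spec v v<m) ⟨
                f (g v)   ≡⟨ cong f gv≡gw ⟩
                f (g w)   ≡⟨ proj₂ (g-spec w w<m) ⟩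
                suc w     ∎))
    where open ≡-Reasoning
  injective : InjectiveBelow m f
  injective x<m y<m fx≡fy with g-onto x<m | g-onto y<m
  ... | v , v<m , refl | w , w<m , refl =
    cong g (suc-injective (trans (sym (proj₂ (g-spec v v<m))) (trans fx≡fy (proj₂ (g-spec w w<m)))))

enumerates-cong : ∀ {m f g} → (∀ c → c < m → f c ≡ g c) → Enumerates m f → Enumerates m g
enumerates-cong {m} {f} {g} f≡g e = record
  { bounded   = λ c<m → subst (λ v → 1 ≤ v × v ≤ m) (f≡g _ c<m) (bounded c<m)
  ; injective = λ x<m y<m gx≡gy → injective x<m y<m (trans (f≡g _ x<m) (trans gx≡gy (sym (f≡g _ y<m))))
  ; onto      = λ 1≤v v≤m → let (c , c<m , fc≡v) = onto 1≤v v≤m in c , c<m , trans (sym (f≡g c c<m)) fc≡v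
  }
  where open Enumerates e

enumerates-count : ∀ {m f v} → Enumerates m f → 1 ≤ v →
  countBelow (λ c → f c ≡ v) (λ c → f c ≟ v) m ≡ indicator (v ≤? m)
enumerates-count {m} {f} {v} e 1≤v with v ≤? m
... | yes v≤m = ≤-antisym
        (countBelow-injectionBelow _ (λ _ → 0) m 1 (λ _ _ _ → s≤s z≤n)
           (λ x<m y<m fx≡v fy≡v _ → injective x<m y<m (trans fx≡v (sym fy≡v))))
        (countBelow-pos _ m (proj₁ (proj₂ (onto 1≤v v≤m))) (proj₂ (proj₂ (onto 1≤v v≤m))))
  where open Enumerates e
... | no v≰m = countBelow-none _ m (λ c c<m fc≡v → v≰m (subst (_≤ m) fc≡v (proj₂ (bounded c<m))))
  where open Enumerates e

-- Transpositions of values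

transpose : ℕ → ℕ → ℕ → ℕ
transpose a b v with v ≟ a | v ≟ b
... | yes _ | _     = b
... | no _  | yes _ = a
... | no _  | no _  = v

data TransposeView (a b v : ℕ) : ℕ → Set where
  at-a  : v ≡ a → TransposeView a b v b
  at-b  : v ≡ b → TransposeView a b v a
  fixed : ¬ v ≡ a → ¬ v ≡ b → TransposeView a b v v

transpose-view : ∀ a b v → TransposeView a b v (transpose a b v)
transpose-view a b v with v ≟ a | v ≟ b
... | yes v≡a | _       = at-a v≡a
... | no _    | yes v≡b = at-b v≡b
... | no v≢a  | no v≢b  = fixed v≢a v≢b

transpose-a : ∀ a b → transpose a b a ≡ b
transpose-a a b with a ≟ a
... | yes _  = refl
... | no a≢a = ⊥-elim (a≢a refl)

transpose-b : ∀ a b → transpose a b b ≡ a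
transpose-b a b with b ≟ a | b ≟ b
... | yes b≡a | _      = b≡a
... | no _    | yes _  = refl
... | no _    | no b≢b = ⊥-elim (b≢b refl)

transpose-fixed : ∀ {a b v} → ¬ v ≡ a → ¬ v ≡ b → transpose a b v ≡ v
transpose-fixed {a} {b} {v} v≢a v≢b with v ≟ a | v ≟ b
... | yes v≡a | _       = ⊥-elim (v≢a v≡a)
... | no _    | yes v≡b = ⊥-elim (v≢b v≡b)
... | no _    | no _    = refl

transpose-involutive : ∀ a b v → transpose a b (transpose a b v) ≡ v
transpose-involutive a b v with transpose a b v | transpose-view a b v
... | _ | at-a refl       = transpose-b a b
... | _ | at-b refl       = transpose-a a b
... | _ | fixed v≢a v≢b   = transpose-fixed v≢a v≢b

transpose-injective : ∀ a b {u v} → transpose a b u ≡ transpose a b v → u ≡ v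
transpose-injective a b {u} {v} eq = begin
  u                                   ≡⟨ transpose-involutive a b u ⟨
  transpose a b (transpose a b u)     ≡⟨ cong (transpose a b) eq ⟩
  transpose a b (transpose a b v)     ≡⟨ transpose-involutive a b v ⟩
  v                                   ∎
  where open ≡-Reasoning

transpose≡⇒≡transpose : ∀ a b {u v} → transpose a b u ≡ v → u ≡ transpose a b v
transpose≡⇒≡transpose a b {u} eq = trans (sym (transpose-involutive a b u)) (cong (transpose a b) eq)

transpose-preserves : ∀ (Q : ℕ → Set) a b v → Q a → Q b → Q v → Q (transpose a b v)
transpose-preserves Q a b v qa qb qv with transpose a b v | transpose-view a b v
... | _ | at-a _    = qb
... | _ | at-b _    = qa
... | _ | fixed _ _ = qv

transpose-reflects : ∀ (Q : ℕ → Set) a b v → Q a → Q b → Q (transpose a b v) → Q v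
transpose-reflects Q a b v qa qb qtv =
  subst Q (transpose-involutive a b v) (transpose-preserves Q a b (transpose a b v) qa qb qtv)

enumerates-transpose : ∀ {m f a b} → Enumerates m f → 1 ≤ a → a ≤ m → 1 ≤ b → b ≤ m →
  Enumerates m (λ c → transpose a b (f c))
enumerates-transpose {m} {f} {a} {b} e 1≤a a≤m 1≤b b≤m = injective⇒enumerates
  (λ c<m → transpose-preserves (λ v → 1 ≤ v × v ≤ m) a b (f _) (1≤a , a≤m) (1≤b , b≤m) (bounded c<m))
  (λ x<m y<m eq → injective x<m y<m (transpose-injective a b eq))
  where open Enumerates e

swapInRows : Tableau → ℕ → ℕ → List ℕ → Tableau
swapInRows T a b Rs r c with r ∈? Rs
... | yes _ = transpose a b (T r c)
... | no _  = T r c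

swapInRows-∈ : ∀ {T a b Rs r} c → r ∈ Rs → swapInRows T a b Rs r c ≡ transpose a b (T r c)
swapInRows-∈ {Rs = Rs} {r = r} _ r∈Rs with r ∈? Rs
... | yes _    = refl
... | no r∉Rs  = ⊥-elim (r∉Rs r∈Rs)

swapInRows-∉ : ∀ {T a b Rs r} c → ¬ r ∈ Rs → swapInRows T a b Rs r c ≡ T r c
swapInRows-∉ {Rs = Rs} {r = r} _ r∉Rs with r ∈? Rs
... | yes r∈Rs = ⊥-elim (r∉Rs r∈Rs)
... | no _     = refl

swapInRows-cases : ∀ T a b Rs r c →
  (r ∈ Rs × swapInRows T a b Rs r c ≡ transpose a b (T r c)) ⊎ (¬ r ∈ Rs × swapInRows T a b Rs r c ≡ T r c)
swapInRows-cases T a b Rs r c with r ∈? Rs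
... | yes r∈Rs = inj₁ (r∈Rs , refl)
... | no r∉Rs  = inj₂ (r∉Rs , refl)

module _ (L : List ℕ) where
  private
    n : ℕ
    n = length L
    ℓ : ℕ → ℕ
    ℓ = part L
    cells : ℕ
    cells = sumBelow ℓ n

  RowsEnumerate : Tableau → Set
  RowsEnumerate T = ∀ {r} → r < n → Enumerates (ℓ r) (T r)

  -- Latin tableaux are weakly Latin

  latin⇒rowsEnumerate : ∀ {T} → IsLatinTableau L T → RowsEnumerate T
  latin⇒rowsEnumerate {T} (positive , rowDistinct , _ , occurs) {r} r<n =
    injective⇒enumerates bounded (rowInjective r<n)
    where
    rowInjective : ∀ {r} → r < n → InjectiveBelow (ℓ r) (T r)
    rowInjective {r} r<n {c} {c′} c<ℓ c′<ℓ eq with c ≟ c′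
    ... | yes c≡c′ = c≡c′
    ... | no c≢c′  = ⊥-elim (rowDistinct r c c′ (r<n , c<ℓ) (r<n , c′<ℓ) c≢c′ eq)

    atMost : ℕ → ℕ → ℕ
    atMost k r = countBelow (λ c → T r c ≤ k) (λ c → T r c ≤? k) (ℓ r)

    atMost≤ : ∀ k {r} → r < n → atMost k r ≤ k ⊓ ℓ r
    atMost≤ k {r} r<n = ⊓-glb
      (countBelow-injectionBelow _ (λ c → T r c ∸ 1) (ℓ r) k
         (λ c c<ℓ → ∸1-< (positive r c (r<n , c<ℓ)))
         (λ x<ℓ y<ℓ _ _ eq → rowInjective r<n x<ℓ y<ℓ
            (∸1-injective (positive r _ (r<n , x<ℓ)) (positive r _ (r<n , y<ℓ)) eq)))
      (countBelow≤n _ (ℓ r))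

    -- Both sides count the cells with entry ≤ k: row by row, and value by value using occurrences = conj.
    sumAtMost : ∀ k → sumBelow (atMost k) n ≡ sumBelow (λ r → k ⊓ ℓ r) n
    sumAtMost k = begin
      sumBelow (atMost k) n
        ≡⟨ sumBelow-cong n (λ r r<n → sumBelow-countBelow-≡ (T r) (ℓ r) (λ c c<ℓ → positive r c (r<n , c<ℓ)) k) ⟨
      sumBelow (λ r → sumBelow (λ i → countBelow (λ c → T r c ≡ suc i) (λ c → T r c ≟ suc i) (ℓ r)) k) n
        ≡⟨ sumBelow-swap (λ i r → countBelow (λ c → T r c ≡ suc i) (λ c → T r c ≟ suc i) (ℓ r)) n k ⟨
      sumBelow (λ i → occurrences L T (suc i)) k
        ≡⟨ sumBelow-cong k (λ i _ → occurs (suc i) (s≤s z≤n)) ⟩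
      sumBelow (λ i → conj L (suc i)) k
        ≡⟨ sumBelow-cong k (λ i _ → countBelow≡sumBelow-indicator (λ r → suc i ≤? ℓ r) n) ⟩
      sumBelow (λ i → sumBelow (λ r → indicator (suc i ≤? ℓ r)) n) k
        ≡⟨ sumBelow-swap (λ i r → indicator (suc i ≤? ℓ r)) n k ⟩
      sumBelow (λ r → sumBelow (λ i → indicator (suc i ≤? ℓ r)) k) n
        ≡⟨ sumBelow-cong n (λ r _ → sumBelow-indicator-≤ (ℓ r) k) ⟩
      sumBelow (λ r → k ⊓ ℓ r) n ∎
      where open ≡-Reasoning

    bounded : ∀ {c} → c < ℓ r → 1 ≤ T r c × T r c ≤ ℓ r
    bounded c<ℓ = positive r _ (r<n , c<ℓ) , countBelow≡n⇒all _ (ℓ r) rowAtMost _ c<ℓ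
      where
      rowAtMost : atMost (ℓ r) r ≡ ℓ r
      rowAtMost = trans (sumBelow-mono-≡⇒≡ n (λ r′ → atMost≤ (ℓ r)) (sumAtMost (ℓ r)) r r<n) (⊓-idem (ℓ r))

  columnsDistinct⇒columnAtMost : ∀ {T} → (∀ r c → InShape L r c → 1 ≤ T r c) →
    (∀ r r′ c → InShape L r c → InShape L r′ c → ¬ r ≡ r′ → ¬ T r c ≡ T r′ c) →
    ∀ c k → columnAtMost L T c k ≤ k
  columnsDistinct⇒columnAtMost {T} positive columnDistinct c k =
    countBelow-injectionBelow _ (λ r → T r c ∸ 1) n k
      (λ r r<n (c<ℓ , Trc≤k) → ∸1-< (positive r c (r<n , c<ℓ)) Trc≤k)
      columnInjective
    where
    columnInjective : InjectiveOn (λ r → c < ℓ r × T r c ≤ k) n (λ r → T r c ∸ 1)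
    columnInjective {r} {r′} r<n r′<n (c<ℓ , _) (c<ℓ′ , _) eq with r ≟ r′
    ... | yes r≡r′ = r≡r′
    ... | no r≢r′  = ⊥-elim (columnDistinct r r′ c (r<n , c<ℓ) (r′<n , c<ℓ′) r≢r′
                       (∸1-injective (positive r c (r<n , c<ℓ)) (positive r′ c (r′<n , c<ℓ′)) eq))

  latin⇒weaklyLatin : ∀ {T} → IsLatinTableau L T → IsWeaklyLatinTableau L T
  latin⇒weaklyLatin latin@(positive , _ , columnDistinct , _) =
    (λ r r<n → let open Enumerates (latin⇒rowsEnumerate latin r<n) in (λ c → bounded) , (λ v → onto))
    , (λ c k _ → columnsDistinct⇒columnAtMost positive columnDistinct c k)

  -- Weakly Latin tableaux are Latin

  Entry : Tableau → ℕ → ℕ → ℕ → Set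
  Entry T r c v = InShape L r c × T r c ≡ v

  entry? : ∀ T r c v → Dec (Entry T r c v)
  entry? T r c v = ((r <? n) ×-dec (c <? ℓ r)) ×-dec (T r c ≟ v)

  entry-column<cells : ∀ {T r c v} → Entry T r c v → c < cells
  entry-column<cells ((r<n , c<ℓ) , _) = <-≤-trans c<ℓ (sumBelow-≥ ℓ n r<n)

  entry-functional : ∀ {T r c v w} → Entry T r c v → Entry T r c w → v ≡ w
  entry-functional (_ , Trc≡v) (_ , Trc≡w) = trans (sym Trc≡v) Trc≡w

  entry-rowInjective : ∀ {T r c c′ v} → RowsEnumerate T → Entry T r c v → Entry T r c′ v → c ≡ c′
  entry-rowInjective rows ((r<n , c<ℓ) , Trc≡v) ((_ , c′<ℓ) , Trc′≡v) =
    Enumerates.injective (rows r<n) c<ℓ c′<ℓ (trans Trc≡v (sym Trc′≡v))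

  entry-≤ℓ : ∀ {T r c v} → RowsEnumerate T → Entry T r c v → v ≤ ℓ r
  entry-≤ℓ rows ((r<n , c<ℓ) , Trc≡v) = subst (_≤ ℓ _) Trc≡v (proj₂ (Enumerates.bounded (rows r<n) c<ℓ))

  ColumnsDistinctBelow : ℕ → Tableau → Set
  ColumnsDistinctBelow a T = ∀ {r r′ c v} → v < a → Entry T r c v → Entry T r′ c v → r ≡ r′

  ColumnBoundFrom : ℕ → Tableau → Set
  ColumnBoundFrom a T = ∀ c k → a ≤ k → columnAtMost L T c k ≤ k

  -- Only the column bounds for k ≥ a are kept: swapping a with a smaller value b can break those with b ≤ k < a.
  record Stage (a : ℕ) (T : Tableau) : Set where
    field
      rows        : RowsEnumerate T
      columnBound : ColumnBoundFrom a T
      distinct    : ColumnsDistinctBelow a T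

  columnsWith : Tableau → ℕ → ℕ
  columnsWith T a = countBelow (λ c → ∃ λ r → r < n × Entry T r c a) (λ c → anyUpTo? (λ r → entry? T r c a) n) cells

  swapInRows-rowsEnumerate : ∀ {T a b Rs} → RowsEnumerate T → 1 ≤ b → b ≤ a → (∀ {r} → r ∈ Rs → a ≤ ℓ r) →
    RowsEnumerate (swapInRows T a b Rs)
  swapInRows-rowsEnumerate {T} {a} {b} {Rs} rows 1≤b b≤a a≤ℓ {r} r<n = byMembership (r ∈? Rs)
    where
    byMembership : Dec (r ∈ Rs) → Enumerates (ℓ r) (swapInRows T a b Rs r)
    byMembership (yes r∈Rs) = enumerates-cong (λ c _ → sym (swapInRows-∈ c r∈Rs))
      (enumerates-transpose (rows r<n) (≤-trans 1≤b b≤a) (a≤ℓ r∈Rs) 1≤b (≤-trans b≤a (a≤ℓ r∈Rs)))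
    byMembership (no r∉Rs)  = enumerates-cong (λ c _ → sym (swapInRows-∉ c r∉Rs)) (rows r<n)

  swapInRows-columnBoundFrom : ∀ {T a b} Rs → b ≤ a → ColumnBoundFrom a T → ColumnBoundFrom a (swapInRows T a b Rs)
  swapInRows-columnBoundFrom {T} {a} {b} Rs b≤a columnBound c k a≤k =
    subst (_≤ k) (sym sameCount) (columnBound c k a≤k)
    where
    b≤k : b ≤ k
    b≤k = ≤-trans b≤a a≤k
    reflects : ∀ r → swapInRows T a b Rs r c ≤ k → T r c ≤ k
    reflects r ≤k with swapInRows-cases T a b Rs r c
    ... | inj₁ (_ , eq) = transpose-reflects (_≤ k) a b (T r c) a≤k b≤k (subst (_≤ k) eq ≤k)
    ... | inj₂ (_ , eq) = subst (_≤ k) eq ≤k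
    preserves : ∀ r → T r c ≤ k → swapInRows T a b Rs r c ≤ k
    preserves r ≤k with swapInRows-cases T a b Rs r c
    ... | inj₁ (_ , eq) = subst (_≤ k) (sym eq) (transpose-preserves (_≤ k) a b (T r c) a≤k b≤k ≤k)
    ... | inj₂ (_ , eq) = subst (_≤ k) (sym eq) ≤k
    sameCount : columnAtMost L (swapInRows T a b Rs) c k ≡ columnAtMost L T c k
    sameCount = countBelow-cong _ _ n (λ r _ (c<ℓ , ≤k) → c<ℓ , reflects r ≤k) (λ r _ (c<ℓ , ≤k) → c<ℓ , preserves r ≤k)

  module KempeChain {T : Tableau} {a b x₀ r₀ : ℕ} (rows : RowsEnumerate T) (distinct : ColumnsDistinctBelow a T)
                    (b<a : b < a) (1≤b : 1 ≤ b) (start : Entry T r₀ x₀ a) (x₀-lacks-b : ∀ r → ¬ Entry T r x₀ b) where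

    private
      a-b-exclusive : ∀ {r c} → Entry T r c a → ¬ Entry T r c b
      a-b-exclusive Ea Eb = <-irrefl (sym (entry-functional {T} Ea Eb)) b<a

    -- Rs holds the rows of an alternating path that starts with the a at (r₀ , x₀) and ends in row h: each a of the
    -- path outside column x₀ shares its column with a b of the path, and the b of row h has no a of the path in its column.
    record Chain (Rs : List ℕ) (h : ℕ) : Set where
      field
        start∈     : r₀ ∈ Rs
        hasA       : ∀ {r} → r ∈ Rs → ∃ λ c → Entry T r c a
        aInjective : ∀ {r r′ c} → r ∈ Rs → r′ ∈ Rs → Entry T r c a → Entry T r′ c a → r ≡ r′
        aMatched   : ∀ {r c} → r ∈ Rs → Entry T r c a → ¬ c ≡ x₀ → ∃ λ r′ → r′ ∈ Rs × Entry T r′ c b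
        head∈      : h ∈ Rs
        headFresh  : ∀ {c s} → Entry T h c b → s ∈ Rs → ¬ Entry T s c a

    initial : Chain (r₀ ∷ []) r₀
    initial = record
      { start∈     = here refl
      ; hasA       = λ { (here refl) → x₀ , start }
      ; aInjective = λ { (here refl) (here refl) _ _ → refl }
      ; aMatched   = λ { (here refl) Ea c≢x₀ → ⊥-elim (c≢x₀ (entry-rowInjective rows Ea start)) }
      ; head∈      = here refl
      ; headFresh  = λ { Eb (here refl) Ea → a-b-exclusive Ea Eb }
      }

    extend : ∀ {Rs h y s} → Chain Rs h → Entry T h y b → Entry T s y a → Chain (s ∷ Rs) s
    extend {Rs} {h} {y} {s} chain Eb Ea = record
      { start∈     = there start∈
      ; hasA       = λ { (here refl) → y , Ea ; (there r∈) → hasA r∈ }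
      ; aInjective = aInjective′
      ; aMatched   = aMatched′
      ; head∈      = here refl
      ; headFresh  = headFresh′
      }
      where
      open Chain chain
      onlyA : ∀ {c} → Entry T s c a → c ≡ y
      onlyA Ea′ = entry-rowInjective rows Ea′ Ea
      s∉Rs : ¬ s ∈ Rs
      s∉Rs s∈Rs = headFresh Eb s∈Rs Ea
      aInjective′ : ∀ {r r′ c} → r ∈ s ∷ Rs → r′ ∈ s ∷ Rs → Entry T r c a → Entry T r′ c a → r ≡ r′
      aInjective′ (here refl) (here refl) _   _ = refl
      aInjective′ (here refl) (there r′∈) Ea₁ Ea₂ with onlyA Ea₁
      ... | refl = ⊥-elim (headFresh Eb r′∈ Ea₂)
      aInjective′ (there r∈) (here refl) Ea₁ Ea₂ with onlyA Ea₂
      ... | refl = ⊥-elim (headFresh Eb r∈ Ea₁)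
      aInjective′ (there r∈) (there r′∈) Ea₁ Ea₂ = aInjective r∈ r′∈ Ea₁ Ea₂
      aMatched′ : ∀ {r c} → r ∈ s ∷ Rs → Entry T r c a → ¬ c ≡ x₀ → ∃ λ r′ → r′ ∈ s ∷ Rs × Entry T r′ c b
      aMatched′ (here refl) Ea′ _ with onlyA Ea′
      ... | refl = h , there head∈ , Eb
      aMatched′ (there r∈) Ea′ c≢x₀ = let (r′ , r′∈ , Eb′) = aMatched r∈ Ea′ c≢x₀ in r′ , there r′∈ , Eb′
      -- An a of the path in the column of the new b would be matched with a b of the path, which by
      -- column-distinctness of b would be this very b, putting s on the path already.
      headFresh′ : ∀ {c t} → Entry T s c b → t ∈ s ∷ Rs → ¬ Entry T t c a
      headFresh′ Eb′ (here refl) Ea′ = a-b-exclusive Ea′ Eb′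
      headFresh′ {c} Eb′ (there t∈) Ea′ with c ≟ x₀
      ... | yes refl  = x₀-lacks-b s Eb′
      ... | no c≢x₀   = let (r′ , r′∈ , Eb″) = aMatched t∈ Ea′ c≢x₀ in s∉Rs (subst (_∈ Rs) (distinct b<a Eb″ Eb′) r′∈)

    aColumns : List ℕ → ℕ
    aColumns Rs = countBelow (λ c → Any (λ r → Entry T r c a) Rs) (λ c → any? (λ r → entry? T r c a) Rs) cells

    extend-aColumns : ∀ {Rs h y s} → Chain Rs h → Entry T h y b → Entry T s y a → aColumns Rs < aColumns (s ∷ Rs)
    extend-aColumns chain Eb Ea = countBelow-mono-< _ _ cells (λ _ _ → there) (entry-column<cells {T} Ea) (here Ea)
      (λ anyA → let (r , r∈ , Ea′) = find anyA in Chain.headFresh chain Eb r∈ Ea′)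

    record Complete : Set where
      field
        {members} : List ℕ
        head end  : ℕ
        chain     : Chain members head
        headB     : Entry T head end b
        endFree   : ∀ s → ¬ Entry T s end a

    complete : Complete
    complete = ascend (λ (Rs , _) → aColumns Rs) cells (λ _ → countBelow≤n _ cells) grow (r₀ ∷ [] , r₀ , initial)
      where
      grow : (s : ∃₂ Chain) → Complete ⊎ ∃ λ s′ → aColumns (proj₁ s) < aColumns (proj₁ s′)
      grow (Rs , h , chain) = extendFrom headB
        where
        open Chain chain
        headB : ∃ λ y → Entry T h y b
        headB with proj₂ (hasA head∈)
        ... | Ea@((h<n , _) , _) with Enumerates.onto (rows h<n) 1≤b (≤-trans (<⇒≤ b<a) (entry-≤ℓ rows Ea))
        ...   | y , y<ℓ , Thy≡b = y , (h<n , y<ℓ) , Thy≡b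
        extendFrom : (∃ λ y → Entry T h y b) → Complete ⊎ ∃ λ s′ → aColumns Rs < aColumns (proj₁ s′)
        extendFrom (y , Eb) with anyUpTo? (λ s → entry? T s y a) n
        ... | yes (s , _ , Ea) = inj₂ ((s ∷ Rs , s , extend chain Eb Ea) , extend-aColumns chain Eb Ea)
        ... | no none          = inj₁ (record
          { chain = chain ; headB = Eb ; endFree = λ s Ea → none (s , proj₁ (proj₁ Ea) , Ea) })

    open Complete complete
    open Chain chain

    swapped : Tableau
    swapped = swapInRows T a b members

    swapped-rows : RowsEnumerate swapped
    swapped-rows = swapInRows-rowsEnumerate rows 1≤b (<⇒≤ b<a) (λ r∈ → entry-≤ℓ rows (proj₂ (hasA r∈)))

    swapped-columnBound : ColumnBoundFrom a T → ColumnBoundFrom a swapped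
    swapped-columnBound = swapInRows-columnBoundFrom members (<⇒≤ b<a)

    b-on-path : ∀ {r r′ c} → r ∈ members → Entry T r c a → Entry T r′ c b → r′ ∈ members
    b-on-path {c = c} r∈ Ea Eb with c ≟ x₀
    ... | yes refl = ⊥-elim (x₀-lacks-b _ Eb)
    ... | no c≢x₀  = let (r″ , r″∈ , Eb′) = aMatched r∈ Ea c≢x₀ in subst (_∈ members) (distinct b<a Eb′ Eb) r″∈

    unswap : ∀ {r c v} → v < a → Entry swapped r c v →
      (r ∈ members × v ≡ b × Entry T r c a) ⊎ (Entry T r c v × (r ∈ members → ¬ v ≡ b))
    unswap {r} {c} {v} v<a (shape , Frc≡v) with swapInRows-cases T a b members r c
    ... | inj₂ (r∉ , Frc≡Trc) = inj₂ ((shape , trans (sym Frc≡Trc) Frc≡v) , λ r∈ → ⊥-elim (r∉ r∈))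
    ... | inj₁ (r∈ , Frc≡tTrc) = byValue (v ≟ b)
      where
      Trc≡tv : T r c ≡ transpose a b v
      Trc≡tv = transpose≡⇒≡transpose a b (trans (sym Frc≡tTrc) Frc≡v)
      byValue : Dec (v ≡ b) → (r ∈ members × v ≡ b × Entry T r c a) ⊎ (Entry T r c v × (r ∈ members → ¬ v ≡ b))
      byValue (yes refl) = inj₁ (r∈ , refl , shape , trans Trc≡tv (transpose-b a b))
      byValue (no v≢b)   = inj₂ ((shape , trans Trc≡tv (transpose-fixed (λ v≡a → <-irrefl v≡a v<a) v≢b)) , λ _ → v≢b)

    swapped-distinct : ColumnsDistinctBelow a swapped
    swapped-distinct v<a E E′ with unswap v<a E | unswap v<a E′
    ... | inj₁ (r∈ , _ , Ea)     | inj₁ (r′∈ , _ , Ea′) = aInjective r∈ r′∈ Ea Ea′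
    ... | inj₂ (Ev , _)          | inj₂ (Ev′ , _)       = distinct v<a Ev Ev′
    ... | inj₁ (r∈ , refl , Ea)  | inj₂ (Eb′ , ¬b)      = ⊥-elim (¬b (b-on-path r∈ Ea Eb′) refl)
    ... | inj₂ (Eb , ¬b)         | inj₁ (r′∈ , refl , Ea′) = ⊥-elim (¬b (b-on-path r′∈ Ea′ Eb) refl)

    -- Every column containing an a still does (the a in column x₀ not on the path, or the b matched with it),
    -- and the column `end` gains one.
    swapped-progress : ∀ {r₁} → ¬ r₀ ≡ r₁ → Entry T r₁ x₀ a → columnsWith T a < columnsWith swapped a
    swapped-progress {r₁} r₀≢r₁ start₁ =
      countBelow-mono-< _ _ cells keepsA (entry-column<cells {T} headB) (head , proj₁ (proj₁ headB) , becomesA head∈ headB)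
        (λ (s , _ , Ea) → endFree s Ea)
      where
      r₁∉ : ¬ r₁ ∈ members
      r₁∉ r₁∈ = r₀≢r₁ (aInjective start∈ r₁∈ start start₁)
      becomesA : ∀ {r c} → r ∈ members → Entry T r c b → Entry swapped r c a
      becomesA r∈ (shape , Trc≡b) = shape , trans (swapInRows-∈ _ r∈) (trans (cong (transpose a b) Trc≡b) (transpose-b a b))
      keepsA : (λ c → ∃ λ r → r < n × Entry T r c a) ⊆ (λ c → ∃ λ r → r < n × Entry swapped r c a) below cells
      keepsA c _ (r , r<n , Ea@(shape , Trc≡a)) with swapInRows-cases T a b members r c
      ... | inj₂ (_ , eq) = r , r<n , shape , trans eq Trc≡a
      ... | inj₁ (r∈ , _) with c ≟ x₀
      ...   | yes refl = r₁ , proj₁ (proj₁ start₁) , proj₁ start₁ , trans (swapInRows-∉ x₀ r₁∉) (proj₂ start₁)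
      ...   | no c≢x₀  = let (r′ , r′∈ , Eb) = aMatched r∈ Ea c≢x₀ in r′ , proj₁ (proj₁ Eb) , becomesA r′∈ Eb

  -- Rows r₀, r₁ and one row for each value 1, …, a give a + 2 entries ≤ a + 1 in column x₀.
  overfullColumn : ∀ {a T x₀ r₀ r₁} → ColumnBoundFrom (suc a) T → ¬ r₀ ≡ r₁ →
    Entry T r₀ x₀ (suc a) → Entry T r₁ x₀ (suc a) → (∀ j → j < a → ∃ λ r → Entry T r x₀ (suc j)) → ⊥
  overfullColumn {a} {T} {x₀} {r₀} {r₁} columnBound r₀≢r₁ E₀ E₁ present = <-irrefl refl (begin
    2 + a                                        ≡⟨ countBelow-⊤ (2 + a) ⟨
    countBelow (λ _ → ⊤) (λ _ → yes tt) (2 + a)  ≤⟨ countBelow-injection (λ _ → yes tt)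
                                                      (λ r → (x₀ <? ℓ r) ×-dec (T r x₀ ≤? suc a)) rowOf (2 + a) n
                                                      (λ j j<2+a _ → counted j j<2+a) (λ j< j′< _ _ → rowOf-injective j< j′<) ⟩
    columnAtMost L T x₀ (suc a)                  ≤⟨ columnBound x₀ (suc a) ≤-refl ⟩
    suc a                                        ∎)
    where
    open ≤-Reasoning
    witness : ∃ λ (g : ℕ → ℕ) → ∀ j → j < a → Entry T (g j) x₀ (suc j)
    witness = choiceBelow present
    rowOf : ℕ → ℕ
    rowOf 0             = r₀
    rowOf 1             = r₁
    rowOf (suc (suc j)) = proj₁ witness j
    valueOf : ℕ → ℕ
    valueOf 0             = suc a
    valueOf 1             = suc a
    valueOf (suc (suc j)) = suc j
    valueOf≤ : ∀ j → j < 2 + a → valueOf j ≤ suc a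
    valueOf≤ 0             _                 = ≤-refl
    valueOf≤ 1             _                 = ≤-refl
    valueOf≤ (suc (suc j)) (s≤s (s≤s j<a)) = m≤n⇒m≤1+n j<a
    rowOf-entry : ∀ j → j < 2 + a → Entry T (rowOf j) x₀ (valueOf j)
    rowOf-entry 0             _                 = E₀
    rowOf-entry 1             _                 = E₁
    rowOf-entry (suc (suc j)) (s≤s (s≤s j<a)) = proj₂ witness j j<a
    counted : ∀ j → j < 2 + a → rowOf j < n × x₀ < ℓ (rowOf j) × T (rowOf j) x₀ ≤ suc a
    counted j j<2+a with rowOf-entry j j<2+a
    ... | (r<n , x₀<ℓ) , eq = r<n , x₀<ℓ , subst (_≤ suc a) (sym eq) (valueOf≤ j j<2+a)
    sameValue : ∀ {j j′} → j < 2 + a → j′ < 2 + a → rowOf j ≡ rowOf j′ → valueOf j ≡ valueOf j′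
    sameValue {j} {j′} j< j′< eq =
      entry-functional {T} (subst (λ r → Entry T r x₀ (valueOf j)) eq (rowOf-entry j j<)) (rowOf-entry j′ j′<)
    rowOf-injective : InjectiveBelow (2 + a) rowOf
    rowOf-injective {0}           {0}            _ _ _ = refl
    rowOf-injective {1}           {1}            _ _ _ = refl
    rowOf-injective {0}           {1}            _ _ eq = ⊥-elim (r₀≢r₁ eq)
    rowOf-injective {1}           {0}            _ _ eq = ⊥-elim (r₀≢r₁ (sym eq))
    rowOf-injective {0}           {suc (suc j)} j< j′<@(s≤s (s≤s j<a)) eq = ⊥-elim (<-irrefl (sym (sameValue j< j′< eq)) (s≤s j<a))
    rowOf-injective {1}           {suc (suc j)} j< j′<@(s≤s (s≤s j<a)) eq = ⊥-elim (<-irrefl (sym (sameValue j< j′< eq)) (s≤s j<a))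
    rowOf-injective {suc (suc j)} {0}            j<@(s≤s (s≤s j<a)) j′< eq = ⊥-elim (<-irrefl (sameValue j< j′< eq) (s≤s j<a))
    rowOf-injective {suc (suc j)} {1}            j<@(s≤s (s≤s j<a)) j′< eq = ⊥-elim (<-irrefl (sameValue j< j′< eq) (s≤s j<a))
    rowOf-injective {suc (suc j)} {suc (suc j′)} j< j′< eq = cong suc (sameValue j< j′< eq)

  missingValue : ∀ {a T x₀ r₀ r₁} → ColumnBoundFrom (suc a) T → ¬ r₀ ≡ r₁ →
    Entry T r₀ x₀ (suc a) → Entry T r₁ x₀ (suc a) → ∃ λ b → b < suc a × 1 ≤ b × ∀ r → ¬ Entry T r x₀ b
  missingValue {a} {T} {x₀} columnBound r₀≢r₁ E₀ E₁
    with anyUpTo? (λ j → ¬? (anyUpTo? (λ r → entry? T r x₀ (suc j)) n)) a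
  ... | yes (j , j<a , absent) = suc j , s≤s j<a , s≤s z≤n , λ r E → absent (r , proj₁ (proj₁ E) , E)
  ... | no ¬absent             = ⊥-elim (overfullColumn columnBound r₀≢r₁ E₀ E₁ present)
    where
    present : ∀ j → j < a → ∃ λ r → Entry T r x₀ (suc j)
    present j j<a with anyUpTo? (λ r → entry? T r x₀ (suc j)) n
    ... | yes (r , _ , E) = r , E
    ... | no none         = ⊥-elim (¬absent (j , j<a , none))

  Conflict : ℕ → Tableau → Set
  Conflict a T = ∃ λ x₀ → x₀ < cells × ∃ λ r₀ → r₀ < n × ∃ λ r₁ → r₁ < n ×
                   ¬ r₀ ≡ r₁ × Entry T r₀ x₀ a × Entry T r₁ x₀ a

  conflict? : ∀ a T → Dec (Conflict a T)
  conflict? a T = anyUpTo? (λ x₀ → anyUpTo? (λ r₀ → anyUpTo? (λ r₁ →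
                    ¬? (r₀ ≟ r₁) ×-dec entry? T r₀ x₀ a ×-dec entry? T r₁ x₀ a) n) n) cells

  noConflict⇒distinct : ∀ {a T} → ColumnsDistinctBelow a T → ¬ Conflict a T → ColumnsDistinctBelow (suc a) T
  noConflict⇒distinct {a} {T} distinct noConflict {r} {r′} {c} v<1+a E E′ with m<1+n⇒m<n∨m≡n v<1+a
  ... | inj₁ v<a  = distinct v<a E E′
  ... | inj₂ refl with r ≟ r′
  ...   | yes r≡r′ = r≡r′
  ...   | no r≢r′  = ⊥-elim (noConflict
                       (c , entry-column<cells {T} E , r , proj₁ (proj₁ E) , r′ , proj₁ (proj₁ E′) , r≢r′ , E , E′))

  resolveConflict : ∀ {a T} → Stage (suc a) T → Conflict (suc a) T →
    ∃ λ T′ → Stage (suc a) T′ × columnsWith T (suc a) < columnsWith T′ (suc a)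
  resolveConflict {a} {T} stage (x₀ , _ , r₀ , _ , r₁ , _ , r₀≢r₁ , E₀ , E₁) =
    swapUsing (missingValue columnBound r₀≢r₁ E₀ E₁)
    where
    open Stage stage
    swapUsing : (∃ λ b → b < suc a × 1 ≤ b × ∀ r → ¬ Entry T r x₀ b) →
      ∃ λ T′ → Stage (suc a) T′ × columnsWith T (suc a) < columnsWith T′ (suc a)
    swapUsing (b , b<a , 1≤b , x₀-lacks-b) =
      swapped , record { rows = swapped-rows ; columnBound = swapped-columnBound columnBound ; distinct = swapped-distinct }
              , swapped-progress r₀≢r₁ E₁
      where open KempeChain rows distinct b<a 1≤b E₀ x₀-lacks-b

  stageStep : ∀ {a T} → Stage (suc a) T → ∃ (Stage (suc (suc a)))
  stageStep {a} {T} stage =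
    ascend (λ (T , _) → columnsWith T (suc a)) cells (λ _ → countBelow≤n _ cells) resolve (T , stage)
    where
    resolve : (s : ∃ (Stage (suc a))) →
      ∃ (Stage (suc (suc a))) ⊎ ∃ λ s′ → columnsWith (proj₁ s) (suc a) < columnsWith (proj₁ s′) (suc a)
    resolve (T , stage) with conflict? (suc a) T
    ... | yes conflict   = let (T′ , stage′ , progress) = resolveConflict stage conflict in inj₂ ((T′ , stage′) , progress)
    ... | no noConflict = inj₁ (T , record
            { rows        = rows
            ; columnBound = λ c k 2+a≤k → columnBound c k (≤-trans (n≤1+n (suc a)) 2+a≤k)
            ; distinct    = noConflict⇒distinct distinct noConflict
            })
      where open Stage stage

  stages : ∀ j {T} → Stage 1 T → ∃ (Stage (suc j))
  stages zero    stage = _ , stage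
  stages (suc j) stage = stageStep (proj₂ (stages j stage))

  weaklyLatin⇒stage₁ : ∀ {T} → IsWeaklyLatinTableau L T → Stage 1 T
  weaklyLatin⇒stage₁ (rowCondition , columnCondition) = record
    { rows        = λ r<n → onto⇒enumerates (proj₁ (rowCondition _ r<n) _) (proj₂ (rowCondition _ r<n) _)
    ; columnBound = columnCondition
    ; distinct    = λ { (s≤s z≤n) ((r<n , c<ℓ) , Trc≡0) _ →
                        ⊥-elim (<-irrefl (sym Trc≡0) (proj₁ (proj₁ (rowCondition _ r<n) _ c<ℓ))) }
    }

  stage⇒latin : ∀ {T} → Stage (suc cells) T → IsLatinTableau L T
  stage⇒latin {T} stage = positive , rowDistinct , columnDistinct , occurs
    where
    open Stage stage
    positive : ∀ r c → InShape L r c → 1 ≤ T r c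
    positive r c (r<n , c<ℓ) = proj₁ (Enumerates.bounded (rows r<n) c<ℓ)
    rowDistinct : ∀ r c c′ → InShape L r c → InShape L r c′ → ¬ c ≡ c′ → ¬ T r c ≡ T r c′
    rowDistinct r c c′ (r<n , c<ℓ) (_ , c′<ℓ) c≢c′ eq = c≢c′ (Enumerates.injective (rows r<n) c<ℓ c′<ℓ eq)
    columnDistinct : ∀ r r′ c → InShape L r c → InShape L r′ c → ¬ r ≡ r′ → ¬ T r c ≡ T r′ c
    columnDistinct r r′ c shape@(r<n , _) shape′ r≢r′ eq = r≢r′ (distinct Trc<1+cells E (shape′ , sym eq))
      where
      E : Entry T r c (T r c)
      E = shape , refl
      Trc<1+cells : T r c < suc cells
      Trc<1+cells = s≤s (≤-trans (entry-≤ℓ rows E) (sumBelow-≥ ℓ n r<n))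
    occurs : ∀ i → 1 ≤ i → occurrences L T i ≡ conj L i
    occurs i 1≤i = trans (sumBelow-cong n (λ r r<n → enumerates-count (rows r<n) 1≤i))
                         (sym (countBelow≡sumBelow-indicator (λ r → i ≤? ℓ r) n))

  weaklyLatin⇒latin : ∀ {T} → IsWeaklyLatinTableau L T → IsLatin L
  weaklyLatin⇒latin weak = let (T , stage) = stages cells (weaklyLatin⇒stage₁ weak) in T , stage⇒latin stage

proposition7 : (λ′ : List ℕ) → IsPartition λ′ →
    (IsWeaklyLatin λ′ → IsLatin λ′) × (IsLatin λ′ → IsWeaklyLatin λ′)
proposition7 L _ = (λ (_ , weak) → weaklyLatin⇒latin L weak) , (λ (T , latin) → T , latin⇒weaklyLatin L latin)
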